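{- Let $a,d$ be numbers and let $A_{n,k}(a,d)$ be the general Eulerian numbers defined in the context. Then for every integer $n\ge 0$ and every integer $k$ with $-1\le k\le n-1$, $$A_{n,k}(a,d)=\sum_{i=0}^{k+1}(-1)^i\big[(k+2-i)d-a\big]^n\binom{n+1}{i}.$$
   Context: For numbers $a,d$ (associated with the arithmetic progression $a, a+d, a+2d,\dots$), the general Eulerian numbers $A_{n,k}(a,d)$, for integers $n\ge 0$ and $k$, are defined by: $A_{0,-1}(a,d)=1$; $A_{n,k}(a,d)=0$ whenever $k\ge n$ or $k\le -2$; and for $n\ge 1$ and $-1\le k\le n-1$, $$A_{n,k}(a,d)=(-a+(k+2)d)\,A_{n-1,k}(a,d)+(a+(n-k-1)d)\,A_{n-1,k-1}(a,d).$$ The convention $x^0=1$ (including $0^0=1$) is used. -}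

module Defs where

open import Level using (Level)
open import Algebra.Bundles using (CommutativeRing; Semiring)
open import Data.Nat as ℕ using (ℕ; zero; suc)
open import Data.Nat.Combinatorics using (_C_)
open import Data.Integer as ℤ using (ℤ; +_; -[1+_]; _≤?_; _≟_)
open import Data.Bool using (Bool; true; false; if_then_else_; _∧_)
open import Relation.Nullary.Decidable using (⌊_⌋)

-- Definitions relative to an arbitrary commutative ring R
-- (the "numbers" a, d live in R).
module GeneralEulerian {c ℓ : Level} (R : CommutativeRing c ℓ) where
  open CommutativeRing R
  open import Algebra.Definitions.RawSemiring (Semiring.rawSemiring semiring) public using (_×_; _^_)
  -- x ^ 0 = 1# for every x (so 0^0 = 1).

  fromℤ : ℤ → Carrier
  fromℤ (+ n)    = n × 1#
  fromℤ -[1+ n ] = - (suc n × 1#)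

  fromℕ : ℕ → Carrier
  fromℕ n = n × 1#

  A : Carrier → Carrier → ℕ → ℤ → Carrier
  A a d zero k = if ⌊ k ≟ ℤ.-1ℤ ⌋ then 1# else 0#
  A a d (suc n) k =
    if ⌊ ℤ.-1ℤ ≤? k ⌋ ∧ ⌊ k ≤? + n ⌋
    then ((- a + fromℤ (k ℤ.+ + 2) * d) * A a d n k
          + (a + fromℤ (+ suc n ℤ.- k ℤ.- + 1) * d) * A a d n (k ℤ.- + 1))
    else 0#

  sumTo : ℕ → (ℕ → Carrier) → Carrier
  sumTo zero    f = f 0
  sumTo (suc m) f = sumTo m f + f (suc m)

  RHS : Carrier → Carrier → ℕ → ℤ → Carrier
  RHS a d n k =
    sumTo (ℤ.∣ k ℤ.+ + 1 ∣) λ i →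
      ((- 1#) ^ i) * ((fromℤ (k ℤ.+ + 2 ℤ.- + i) * d - a) ^ n) * fromℕ (suc n C i)

module Submission where

-- Write k = j - 1 with j ∈ ℕ and put, in a commutative ring R,
--   w j i   = (j + 1 - i)·d - a,
--   S n j   = Σ_{i=0}^{j} (-1)^i · (w j i)^n · C(n+1, i).
-- The proof shows that S and A satisfy the same recurrence and the same
-- boundary conditions:
--   * termwise, using Pascal's rule and the absorption identity
--     (i+1)·C(m,i+1) + i·C(m,i) = m·C(m,i), the closed form obeys
--     S (n+1) j = X j · S n j + Y n j · S n (j-1) with exactly the
--     coefficients X, Y of the Eulerian recurrence;
--   * from this recurrence, S n j = 0 as soon as j > n, just as A n (j-1) = 0;
--   * hence A n (j-1) = S n j for ALL j, by induction on n.

open import Defs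
open import Level using (Level)
open import Algebra.Bundles using (CommutativeRing)
open import Data.Nat as ℕ using (ℕ; zero; suc; z≤n; s≤s)
import Data.Nat.Properties as ℕP
open import Data.Nat.Combinatorics using (_C_; nC1≡n; nCk+nC[k+1]≡[n+1]C[k+1])
open import Data.Integer as ℤ using (ℤ; +_; -[1+_]; -1ℤ)
import Data.Integer.Properties as ℤP
open import Data.Sign as Sign using (Sign)
open import Data.Maybe using (Maybe; just; nothing)
open import Data.Sum using (inj₁; inj₂)
open import Data.Empty using (⊥-elim)
open import Relation.Nullary using (yes; no)
open import Relation.Binary.PropositionalEquality as ≡ using (_≡_)

-- Absorption identity (i+1)·C(m,i+1) + i·C(m,i) = m·C(m,i), a form of
-- (i+1)·C(m,i+1) = (m-i)·C(m,i) free of truncated subtraction.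
-- It is what makes the closed form satisfy the Eulerian recurrence.
module _ where
  open import Data.Nat using (_+_; _*_)
  open import Data.Nat.Tactic.RingSolver using (solve-∀)
  open ≡.≡-Reasoning

  pascal : ∀ n k → suc n C suc k ≡ n C k + n C suc k
  pascal n k = ≡.sym (nCk+nC[k+1]≡[n+1]C[k+1] n k)

  binomial-absorption : ∀ m i → suc i * (m C suc i) + i * (m C i) ≡ m * (m C i)
  binomial-absorption zero    zero    = ≡.refl
  binomial-absorption zero    (suc i) = ≡.cong₂ _+_ (ℕP.*-zeroʳ (suc (suc i))) (ℕP.*-zeroʳ (suc i))
  binomial-absorption (suc m) zero    = begin
    1 * (suc m C 1) + 0     ≡⟨ ℕP.+-identityʳ _ ⟩
    1 * (suc m C 1)         ≡⟨ ℕP.*-identityˡ _ ⟩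
    suc m C 1               ≡⟨ nC1≡n (suc m) ⟩
    suc m                   ≡⟨ ℕP.*-identityʳ (suc m) ⟨
    suc m * 1               ∎
  binomial-absorption (suc m) (suc k) = begin
    suc i * (suc m C suc i) + i * (suc m C i)
      ≡⟨ ≡.cong₂ (λ x y → suc i * x + i * y) (pascal m i) (pascal m k) ⟩
    suc i * (X + Z) + i * (Y + X)
      ≡⟨ regroup k X Y Z ⟩
    (suc i * Z + i * X) + X + Y + (suc k * X + k * Y)
      ≡⟨ ≡.cong₂ (λ x y → x + X + Y + y) (binomial-absorption m i) (binomial-absorption m k) ⟩
    m * X + X + Y + m * Y
      ≡⟨ collect m X Y ⟩
    suc m * (Y + X)
      ≡⟨ ≡.cong (suc m *_) (pascal m k) ⟨
    suc m * (suc m C suc k) ∎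
    where
    i X Y Z : ℕ
    i = suc k
    X = m C i
    Y = m C k
    Z = m C suc i
    regroup : ∀ k X Y Z → suc (suc k) * (X + Z) + suc k * (Y + X)
                        ≡ (suc (suc k) * Z + suc k * X) + X + Y + (suc k * X + k * Y)
    regroup = solve-∀
    collect : ∀ m X Y → m * X + X + Y + m * Y ≡ suc m * (Y + X)
    collect = solve-∀

-- The canonical map ℤ → R is a ring homomorphism; consequently the ring
-- solver with integer coefficients is available for R.
module IntegerImage {c ℓ : Level} (R : CommutativeRing c ℓ) where
  open CommutativeRing R
  open GeneralEulerian R
  open import Algebra.Properties.Ring ring using (-0#≈0#; -‿distribˡ-*; -‿distribʳ-*; ⁻¹-anti-homo‿-; -‿+-comm; -‿involutive)
  open import Algebra.Properties.Group +-group using (//-rightDividesʳ)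
  import Algebra.Properties.Monoid.Mult +-monoid as Mult
  import Algebra.Properties.Semiring.Mult semiring as SemiringMult
  open import Relation.Binary.Reasoning.Setoid setoid

  fromℕ-+ : ∀ m n → fromℕ (m ℕ.+ n) ≈ fromℕ m + fromℕ n
  fromℕ-+ m n = Mult.×-homo-+ 1# m n

  fromℕ-* : ∀ m n → fromℕ (m ℕ.* n) ≈ fromℕ m * fromℕ n
  fromℕ-* = SemiringMult.×1-homo-*

  fromℤ-neg : ∀ i → fromℤ (ℤ.- i) ≈ - fromℤ i
  fromℤ-neg (+ zero)  = sym -0#≈0#
  fromℤ-neg (+ suc n) = refl
  fromℤ-neg -[1+ n ]  = sym (-‿involutive _)

  cancel-+- : ∀ x y → (x + y) - y ≈ x
  cancel-+- x y = //-rightDividesʳ y x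

  fromℤ-⊖ : ∀ m n → fromℤ (m ℤ.⊖ n) ≈ fromℕ m - fromℕ n
  fromℤ-⊖ m n with ℕP.≤-total n m
  ... | inj₁ n≤m = begin
    fromℤ (m ℤ.⊖ n)                       ≡⟨ ≡.cong fromℤ (ℤP.⊖-≥ n≤m) ⟩
    fromℕ (m ℕ.∸ n)                       ≈⟨ cancel-+- _ _ ⟨
    (fromℕ (m ℕ.∸ n) + fromℕ n) - fromℕ n  ≈⟨ +-congʳ (fromℕ-+ (m ℕ.∸ n) n) ⟨
    fromℕ (m ℕ.∸ n ℕ.+ n) - fromℕ n        ≡⟨ ≡.cong (λ z → fromℕ z - fromℕ n) (ℕP.m∸n+n≡m n≤m) ⟩
    fromℕ m - fromℕ n                     ∎
  ... | inj₂ m≤n = begin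
    fromℤ (m ℤ.⊖ n)                           ≡⟨ ≡.cong fromℤ (ℤP.⊖-≤ m≤n) ⟩
    fromℤ (ℤ.- (+ (n ℕ.∸ m)))                 ≈⟨ fromℤ-neg (+ (n ℕ.∸ m)) ⟩
    - fromℕ (n ℕ.∸ m)                         ≈⟨ -‿cong (cancel-+- _ _) ⟨
    - ((fromℕ (n ℕ.∸ m) + fromℕ m) - fromℕ m)  ≈⟨ -‿cong (+-congʳ (fromℕ-+ (n ℕ.∸ m) m)) ⟨
    - (fromℕ (n ℕ.∸ m ℕ.+ m) - fromℕ m)        ≡⟨ ≡.cong (λ z → - (fromℕ z - fromℕ m)) (ℕP.m∸n+n≡m m≤n) ⟩
    - (fromℕ n - fromℕ m)                     ≈⟨ ⁻¹-anti-homo‿- (fromℕ n) (fromℕ m) ⟩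
    fromℕ m - fromℕ n                         ∎

  fromℤ-+ : ∀ i j → fromℤ (i ℤ.+ j) ≈ fromℤ i + fromℤ j
  fromℤ-+ (+ m)    (+ n)    = fromℕ-+ m n
  fromℤ-+ (+ m)    -[1+ n ] = fromℤ-⊖ m (suc n)
  fromℤ-+ -[1+ m ] (+ n)    = trans (fromℤ-⊖ n (suc m)) (+-comm _ _)
  fromℤ-+ -[1+ m ] -[1+ n ] = begin
    - fromℕ (suc (suc (m ℕ.+ n)))      ≡⟨ ≡.cong (λ z → - fromℕ (suc z)) (ℕP.+-suc m n) ⟨
    - fromℕ (suc m ℕ.+ suc n)          ≈⟨ -‿cong (fromℕ-+ (suc m) (suc n)) ⟩
    - (fromℕ (suc m) + fromℕ (suc n))  ≈⟨ -‿+-comm _ _ ⟨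
    - fromℕ (suc m) + - fromℕ (suc n)  ∎

  fromℤ-- : ∀ i j → fromℤ (i ℤ.- j) ≈ fromℤ i - fromℤ j
  fromℤ-- i j = trans (fromℤ-+ i (ℤ.- j)) (+-congˡ (fromℤ-neg j))

  -- Multiplicativity goes through the sign/magnitude decomposition of ℤ.
  signed : Sign → Carrier → Carrier
  signed Sign.+ x = x
  signed Sign.- x = - x

  signed-cong : ∀ s {x y} → x ≈ y → signed s x ≈ signed s y
  signed-cong Sign.+ x≈y = x≈y
  signed-cong Sign.- x≈y = -‿cong x≈y

  signed-* : ∀ s t x y → signed (s Sign.* t) (x * y) ≈ signed s x * signed t y
  signed-* Sign.+ Sign.+ x y = refl
  signed-* Sign.+ Sign.- x y = -‿distribʳ-* x y
  signed-* Sign.- Sign.+ x y = -‿distribˡ-* x y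
  signed-* Sign.- Sign.- x y = begin
    x * y          ≈⟨ -‿involutive _ ⟨
    - - (x * y)    ≈⟨ -‿cong (-‿distribˡ-* x y) ⟩
    - (- x * y)    ≈⟨ -‿distribʳ-* (- x) y ⟩
    - x * - y      ∎

  fromℤ-◃ : ∀ s n → fromℤ (s ℤ.◃ n) ≈ signed s (fromℕ n)
  fromℤ-◃ Sign.+ zero    = refl
  fromℤ-◃ Sign.- zero    = sym -0#≈0#
  fromℤ-◃ Sign.+ (suc n) = refl
  fromℤ-◃ Sign.- (suc n) = refl

  fromℤ-sign-abs : ∀ i → fromℤ i ≈ signed (ℤ.sign i) (fromℕ ℤ.∣ i ∣)
  fromℤ-sign-abs (+ zero)  = refl
  fromℤ-sign-abs (+ suc n) = refl
  fromℤ-sign-abs -[1+ n ]  = refl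

  fromℤ-* : ∀ i j → fromℤ (i ℤ.* j) ≈ fromℤ i * fromℤ j
  fromℤ-* i j = begin
    fromℤ (i ℤ.* j)                         ≈⟨ fromℤ-◃ s (ℤ.∣ i ∣ ℕ.* ℤ.∣ j ∣) ⟩
    signed s (fromℕ (ℤ.∣ i ∣ ℕ.* ℤ.∣ j ∣))     ≈⟨ signed-cong s (fromℕ-* ℤ.∣ i ∣ ℤ.∣ j ∣) ⟩
    signed s (fromℕ ℤ.∣ i ∣ * fromℕ ℤ.∣ j ∣)   ≈⟨ signed-* (ℤ.sign i) (ℤ.sign j) _ _ ⟩
    signed (ℤ.sign i) (fromℕ ℤ.∣ i ∣) * signed (ℤ.sign j) (fromℕ ℤ.∣ j ∣)
                                            ≈⟨ *-cong (fromℤ-sign-abs i) (fromℤ-sign-abs j) ⟨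
    fromℤ i * fromℤ j                       ∎
    where
    s : Sign
    s = ℤ.sign i Sign.* ℤ.sign j

  -- A variant of fromℤ sending 0 and ±1 to 0#, 1#, - 1# on the nose, so that
  -- solver equations can mention these constants literally.
  fromℤ′ : ℤ → Carrier
  fromℤ′ (+ zero)          = 0#
  fromℤ′ (+ suc zero)      = 1#
  fromℤ′ (+ suc (suc n))   = fromℤ (+ suc (suc n))
  fromℤ′ -[1+ zero ]       = - 1#
  fromℤ′ -[1+ suc n ]      = fromℤ -[1+ suc n ]

  fromℤ′≈fromℤ : ∀ i → fromℤ′ i ≈ fromℤ i
  fromℤ′≈fromℤ (+ zero)        = refl
  fromℤ′≈fromℤ (+ suc zero)    = sym (+-identityʳ 1#)
  fromℤ′≈fromℤ (+ suc (suc n)) = refl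
  fromℤ′≈fromℤ -[1+ zero ]     = -‿cong (sym (+-identityʳ 1#))
  fromℤ′≈fromℤ -[1+ suc n ]    = refl

  open import Algebra.Solver.Ring.AlmostCommutativeRing
    using (fromCommutativeRing; _-Raw-AlmostCommutative⟶_)

  fromℤ′-homomorphism :
    CommutativeRing.rawRing ℤP.+-*-commutativeRing -Raw-AlmostCommutative⟶ fromCommutativeRing R
  fromℤ′-homomorphism = record
    { ⟦_⟧    = fromℤ′
    ; +-homo = λ i j → transport (ℤ._+_ i j) (fromℤ-+ i j) (+-cong (fromℤ′≈fromℤ i) (fromℤ′≈fromℤ j))
    ; *-homo = λ i j → transport (ℤ._*_ i j) (fromℤ-* i j) (*-cong (fromℤ′≈fromℤ i) (fromℤ′≈fromℤ j))
    ; -‿homo = λ i → transport (ℤ.- i) (fromℤ-neg i) (-‿cong (fromℤ′≈fromℤ i))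
    ; 0-homo = refl
    ; 1-homo = refl
    }
    where
    transport : ∀ k {x y} → fromℤ k ≈ x → y ≈ x → fromℤ′ k ≈ y
    transport k k≈x y≈x = trans (fromℤ′≈fromℤ k) (trans k≈x (sym y≈x))

  equal-coefficients? : ∀ i j → Maybe (fromℤ′ i ≈ fromℤ′ j)
  equal-coefficients? i j with i ℤ.≟ j
  ... | yes ≡.refl = just refl
  ... | no _       = nothing

  open import Algebra.Solver.Ring (CommutativeRing.rawRing ℤP.+-*-commutativeRing)
    (fromCommutativeRing R) fromℤ′-homomorphism equal-coefficients? public
    using (solve; _:+_; _:-_; _:*_; :-_; _:=_; con)

module FiniteSums {c ℓ : Level} (R : CommutativeRing c ℓ) where
  open CommutativeRing R
  open GeneralEulerian R
  open import Algebra.Properties.CommutativeSemigroup +-commutativeSemigroup using (interchange)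

  sumTo-cong : ∀ m {f g : ℕ → Carrier} → (∀ i → f i ≈ g i) → sumTo m f ≈ sumTo m g
  sumTo-cong zero    f≈g = f≈g 0
  sumTo-cong (suc m) f≈g = +-cong (sumTo-cong m f≈g) (f≈g (suc m))

  sumTo-+ : ∀ m (f g : ℕ → Carrier) → sumTo m (λ i → f i + g i) ≈ sumTo m f + sumTo m g
  sumTo-+ zero    f g = refl
  sumTo-+ (suc m) f g = trans (+-congʳ (sumTo-+ m f g)) (interchange _ _ _ _)

  sumTo-*ˡ : ∀ m x (f : ℕ → Carrier) → sumTo m (λ i → x * f i) ≈ x * sumTo m f
  sumTo-*ˡ zero    x f = refl
  sumTo-*ˡ (suc m) x f = trans (+-congʳ (sumTo-*ˡ m x f)) (sym (distribˡ x _ _))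

  sumTo-shift : ∀ m (f : ℕ → Carrier) → sumTo (suc m) f ≈ f 0 + sumTo m (λ i → f (suc i))
  sumTo-shift zero    f = refl
  sumTo-shift (suc m) f = trans (+-congʳ (sumTo-shift m f)) (+-assoc _ _ _)

module ClosedForm {c ℓ : Level} (R : CommutativeRing c ℓ) (a d : CommutativeRing.Carrier R) where
  open CommutativeRing R
  open GeneralEulerian R
  open IntegerImage R
  open FiniteSums R
  open import Algebra.Properties.Semiring.Exp semiring using (^-congˡ)
  open import Relation.Binary.Reasoning.Setoid setoid

  w : ℕ → ℕ → Carrier
  w j i = (fromℕ (suc j) - fromℕ i) * d - a

  term : ℕ → ℕ → ℕ → Carrier
  term n j i = (- 1#) ^ i * w j i ^ n * fromℕ (suc n C i)

  S : ℕ → ℕ → Carrier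
  S n j = sumTo j (term n j)

  -- S n (j - 1), read as 0 for j = 0 (mirroring A n (-2) = 0)
  S₋ : ℕ → ℕ → Carrier
  S₋ n zero    = 0#
  S₋ n (suc j) = S n j

  -- the coefficients of the Eulerian recurrence for k = j - 1:
  -- X j = -a + (k+2)·d   and   Y n j = a + ((n+1) - k - 1)·d
  X : ℕ → Carrier
  X j = - a + fromℕ (suc j) * d

  Y : ℕ → ℕ → Carrier
  Y n j = a + (fromℕ (suc n) - fromℕ j) * d

  absorption : ∀ n i → (1# + fromℕ i) * fromℕ (suc n C suc i) + fromℕ i * fromℕ (suc n C i)
                       ≈ fromℕ (suc n) * fromℕ (suc n C i)
  absorption n i = begin
    (1# + fromℕ i) * fromℕ (suc n C suc i) + fromℕ i * fromℕ (suc n C i)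
      ≈⟨ +-cong (fromℕ-* (suc i) (suc n C suc i)) (fromℕ-* i (suc n C i)) ⟨
    fromℕ (suc i ℕ.* (suc n C suc i)) + fromℕ (i ℕ.* (suc n C i))
      ≈⟨ fromℕ-+ (suc i ℕ.* (suc n C suc i)) (i ℕ.* (suc n C i)) ⟨
    fromℕ (suc i ℕ.* (suc n C suc i) ℕ.+ i ℕ.* (suc n C i))
      ≡⟨ ≡.cong fromℕ (binomial-absorption (suc n) i) ⟩
    fromℕ (suc n ℕ.* (suc n C i))
      ≈⟨ fromℕ-* (suc n) (suc n C i) ⟩
    fromℕ (suc n) * fromℕ (suc n C i) ∎

  pascalR : ∀ n i → fromℕ (suc (suc n) C suc i) ≈ fromℕ (suc n C i) + fromℕ (suc n C suc i)
  pascalR n i = trans (reflexive (≡.cong fromℕ (pascal (suc n) i))) (fromℕ-+ (suc n C i) (suc n C suc i))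

  term-zero : ∀ n j → term (suc n) j 0 ≈ X j * term n j 0
  term-zero n j = expand (fromℕ (suc j)) (w j 0 ^ n) d a
    where
    expand : ∀ J P d a → 1# * (((J - 0#) * d - a) * P) * (1# + 0#) ≈ (- a + J * d) * (1# * P * (1# + 0#))
    expand = solve 4 (λ J P d a →
        con (+ 1) :* (((J :- con (+ 0)) :* d :- a) :* P) :* (con (+ 1) :+ con (+ 0))
      := (:- a :+ J :* d) :* (con (+ 1) :* P :* (con (+ 1) :+ con (+ 0)))) refl

  -- With W = w j i = w (j+1) (i+1) and s = (-1)^i this is
  --   -s·W^(n+1)·(C0 + C1) = (W + (i+1)d)·(-s·W^n·C1) + ((n+1-i)d - W)·(s·W^n·C0),
  -- which holds because (i+1)·C1 = (n+1-i)·C0 by absorption.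
  term-suc : ∀ n j i → term (suc n) (suc j) (suc i)
                       ≈ X (suc j) * term n (suc j) (suc i) + Y n (suc j) * term n j i
  term-suc n j i = begin
    (- 1# * s) * (w (suc j) (suc i) ^ suc n) * fromℕ (suc (suc n) C suc i)
      ≈⟨ *-cong (*-congˡ (^-congˡ (suc n) w-shift)) (pascalR n i) ⟩
    (- 1# * s) * (W * P) * (C0 + C1)
      ≈⟨ +-identityʳ _ ⟨
    (- 1# * s) * (W * P) * (C0 + C1) + 0#
      ≈⟨ +-congˡ correction≈0 ⟨
    (- 1# * s) * (W * P) * (C0 + C1) + s * P * d * (N * C0 - ((1# + I) * C1 + I * C0))
      ≈⟨ regroup s P J I d a C0 C1 N ⟩
    (- a + (1# + J) * d) * ((- 1# * s) * P * C1) + (a + (N - J) * d) * (s * P * C0)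
      ≈⟨ +-congʳ (*-congˡ (*-congʳ (*-congˡ (^-congˡ n w-shift)))) ⟨
    X (suc j) * term n (suc j) (suc i) + Y n (suc j) * term n j i ∎
    where
    s J I W P N C0 C1 : Carrier
    s  = (- 1#) ^ i
    J  = fromℕ (suc j)
    I  = fromℕ i
    W  = w j i
    P  = W ^ n
    N  = fromℕ (suc n)
    C0 = fromℕ (suc n C i)
    C1 = fromℕ (suc n C suc i)
    w-shift : w (suc j) (suc i) ≈ W
    w-shift = cancel-one J I d a
      where
      cancel-one : ∀ J c d a → ((1# + J) - (1# + c)) * d - a ≈ (J - c) * d - a
      cancel-one = solve 4 (λ J c d a →
        ((con (+ 1) :+ J) :- (con (+ 1) :+ c)) :* d :- a := (J :- c) :* d :- a) refl
    correction≈0 : s * P * d * (N * C0 - ((1# + I) * C1 + I * C0)) ≈ 0#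
    correction≈0 = begin
      s * P * d * (N * C0 - ((1# + I) * C1 + I * C0)) ≈⟨ *-congˡ (+-congˡ (-‿cong (absorption n i))) ⟩
      s * P * d * (N * C0 - N * C0)                   ≈⟨ *-congˡ (-‿inverseʳ _) ⟩
      s * P * d * 0#                                  ≈⟨ zeroʳ _ ⟩
      0#                                              ∎
    regroup : ∀ s P J c d a C0 C1 N →
      (- 1# * s) * (((J - c) * d - a) * P) * (C0 + C1) + s * P * d * (N * C0 - ((1# + c) * C1 + c * C0))
      ≈ (- a + (1# + J) * d) * ((- 1# * s) * P * C1) + (a + (N - J) * d) * (s * P * C0)
    regroup = solve 9 (λ s P J c d a C0 C1 N →
        (:- con (+ 1) :* s) :* (((J :- c) :* d :- a) :* P) :* (C0 :+ C1)
          :+ s :* P :* d :* (N :* C0 :- ((con (+ 1) :+ c) :* C1 :+ c :* C0))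
      := (:- a :+ (con (+ 1) :+ J) :* d) :* ((:- con (+ 1) :* s) :* P :* C1)
          :+ (a :+ (N :- J) :* d) :* (s :* P :* C0)) refl

  closed-recurrence : ∀ n j → S (suc n) j ≈ X j * S n j + Y n j * S₋ n j
  closed-recurrence n zero = begin
    term (suc n) 0 0                   ≈⟨ term-zero n 0 ⟩
    X 0 * term n 0 0                   ≈⟨ +-identityʳ _ ⟨
    X 0 * term n 0 0 + 0#              ≈⟨ +-congˡ (zeroʳ (Y n 0)) ⟨
    X 0 * term n 0 0 + Y n 0 * 0#      ∎
  closed-recurrence n (suc j) = begin
    S (suc n) (suc j)
      ≈⟨ sumTo-shift j (term (suc n) (suc j)) ⟩
    term (suc n) (suc j) 0 + sumTo j (λ i → term (suc n) (suc j) (suc i))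
      ≈⟨ +-cong (term-zero n (suc j)) (sumTo-cong j (term-suc n j)) ⟩
    X′ * T 0 + sumTo j (λ i → X′ * T (suc i) + Y′ * term n j i)
      ≈⟨ +-congˡ (sumTo-+ j _ _) ⟩
    X′ * T 0 + (sumTo j (λ i → X′ * T (suc i)) + sumTo j (λ i → Y′ * term n j i))
      ≈⟨ +-congˡ (+-cong (sumTo-*ˡ j X′ _) (sumTo-*ˡ j Y′ _)) ⟩
    X′ * T 0 + (X′ * sumTo j (λ i → T (suc i)) + Y′ * S n j)
      ≈⟨ +-assoc _ _ _ ⟨
    (X′ * T 0 + X′ * sumTo j (λ i → T (suc i))) + Y′ * S n j
      ≈⟨ +-congʳ (distribˡ X′ _ _) ⟨
    X′ * (T 0 + sumTo j (λ i → T (suc i))) + Y′ * S n j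
      ≈⟨ +-congʳ (*-congˡ (sumTo-shift j T)) ⟨
    X′ * S n (suc j) + Y′ * S n j ∎
    where
    X′ Y′ : Carrier
    T  : ℕ → Carrier
    X′ = X (suc j)
    Y′ = Y n (suc j)
    T  = term n (suc j)

  alternating-row-one : ∀ m → sumTo (suc m) (λ i → (- 1#) ^ i * 1# * fromℕ (1 C i)) ≈ 0#
  alternating-row-one zero    = solve 0 (con (+ 1) :* con (+ 1) :* (con (+ 1) :+ con (+ 0))
      :+ (:- con (+ 1) :* con (+ 1)) :* con (+ 1) :* (con (+ 1) :+ con (+ 0)) := con (+ 0)) refl
  alternating-row-one (suc m) = begin
    sumTo (suc m) _ + (- 1#) ^ suc (suc m) * 1# * 0# ≈⟨ +-cong (alternating-row-one m) (zeroʳ _) ⟩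
    0# + 0#                                          ≈⟨ +-identityʳ 0# ⟩
    0#                                               ∎

  closed-vanishes : ∀ n j → n ℕ.< j → S n j ≈ 0#
  closed-vanishes zero    (suc j) _           = alternating-row-one j
  closed-vanishes (suc n) (suc j) (s≤s n<j) = begin
    S (suc n) (suc j)                                ≈⟨ closed-recurrence n (suc j) ⟩
    X (suc j) * S n (suc j) + Y n (suc j) * S n j    ≈⟨ +-cong (*-congˡ (closed-vanishes n (suc j) (ℕP.m≤n⇒m≤1+n n<j)))
                                                               (*-congˡ (closed-vanishes n j n<j)) ⟩
    X (suc j) * 0# + Y n (suc j) * 0#                ≈⟨ +-cong (zeroʳ _) (zeroʳ _) ⟩
    0# + 0#                                          ≈⟨ +-identityʳ 0# ⟩
    0#                                               ∎

module EulerianClosedForm {c ℓ : Level} (R : CommutativeRing c ℓ) (a d : CommutativeRing.Carrier R) where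
  open CommutativeRing R
  open GeneralEulerian R
  open IntegerImage R
  open FiniteSums R
  open ClosedForm R a d
  open import Algebra.Properties.Semiring.Exp semiring using (^-congˡ)
  open import Relation.Binary.Reasoning.Setoid setoid

  κ : ℕ → ℤ
  κ zero    = -1ℤ
  κ (suc j) = + j

  κ-pred : ∀ j → κ (suc j) ℤ.- + 1 ≡ κ j
  κ-pred zero    = ≡.refl
  κ-pred (suc j) = ≡.refl

  fromℤ-κ : ∀ j → fromℤ (κ j) ≈ fromℕ j - 1#
  fromℤ-κ zero    = solve 0 (:- (con (+ 1) :+ con (+ 0)) := con (+ 0) :- con (+ 1)) refl
  fromℤ-κ (suc j) = solve 1 (λ J → J := (con (+ 1) :+ J) :- con (+ 1)) refl (fromℕ j)

  fromℤ-κ+2 : ∀ j → fromℤ (κ j ℤ.+ + 2) ≈ fromℕ (suc j)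
  fromℤ-κ+2 j = begin
    fromℤ (κ j ℤ.+ + 2)                  ≈⟨ fromℤ-+ (κ j) (+ 2) ⟩
    fromℤ (κ j) + fromℤ (+ 2)            ≈⟨ +-congʳ (fromℤ-κ j) ⟩
    (fromℕ j - 1#) + (1# + (1# + 0#))    ≈⟨ simplify (fromℕ j) ⟩
    fromℕ (suc j)                        ∎
    where
    simplify : ∀ J → (J - 1#) + (1# + (1# + 0#)) ≈ 1# + J
    simplify = solve 1 (λ J → (J :- con (+ 1)) :+ (con (+ 1) :+ (con (+ 1) :+ con (+ 0)))
                            := con (+ 1) :+ J) refl

  fromℤ-lower-coefficient : ∀ n j → fromℤ (+ suc n ℤ.- κ j ℤ.- + 1) ≈ fromℕ (suc n) - fromℕ j
  fromℤ-lower-coefficient n j = begin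
    fromℤ (+ suc n ℤ.- κ j ℤ.- + 1)          ≈⟨ fromℤ-- (+ suc n ℤ.- κ j) (+ 1) ⟩
    fromℤ (+ suc n ℤ.- κ j) - fromℤ (+ 1)    ≈⟨ +-congʳ (fromℤ-- (+ suc n) (κ j)) ⟩
    (N - fromℤ (κ j)) - (1# + 0#)            ≈⟨ +-congʳ (+-congˡ (-‿cong (fromℤ-κ j))) ⟩
    (N - (fromℕ j - 1#)) - (1# + 0#)         ≈⟨ simplify N (fromℕ j) ⟩
    N - fromℕ j                              ∎
    where
    N : Carrier
    N = fromℕ (suc n)
    simplify : ∀ N J → (N - (J - 1#)) - (1# + 0#) ≈ N - J
    simplify = solve 2 (λ N J → (N :- (J :- con (+ 1))) :- (con (+ 1) :+ con (+ 0)) := N :- J) refl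

  A-unfold : ∀ n k → -1ℤ ℤ.≤ k → k ℤ.≤ + n →
    A a d (suc n) k ≡ (- a + fromℤ (k ℤ.+ + 2) * d) * A a d n k
                      + (a + fromℤ (+ suc n ℤ.- k ℤ.- + 1) * d) * A a d n (k ℤ.- + 1)
  A-unfold n k -1≤k k≤n with -1ℤ ℤ.≤? k | k ℤ.≤? + n
  ... | yes _    | yes _    = ≡.refl
  ... | no -1≰k  | _        = ⊥-elim (-1≰k -1≤k)
  ... | yes _    | no k≰n   = ⊥-elim (k≰n k≤n)

  A-recurrence : ∀ n j → j ℕ.≤ suc n →
    A a d (suc n) (κ j) ≈ X j * A a d n (κ j) + Y n j * A a d n (κ j ℤ.- + 1)
  A-recurrence n j j≤1+n = begin
    A a d (suc n) (κ j)
      ≡⟨ A-unfold n (κ j) (-1≤κ j) (κ≤n j j≤1+n) ⟩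
    (- a + fromℤ (κ j ℤ.+ + 2) * d) * A a d n (κ j)
      + (a + fromℤ (+ suc n ℤ.- κ j ℤ.- + 1) * d) * A a d n (κ j ℤ.- + 1)
      ≈⟨ +-cong (*-congʳ (+-congˡ (*-congʳ (fromℤ-κ+2 j))))
                (*-congʳ (+-congˡ (*-congʳ (fromℤ-lower-coefficient n j)))) ⟩
    X j * A a d n (κ j) + Y n j * A a d n (κ j ℤ.- + 1) ∎
    where
    -1≤κ : ∀ j → -1ℤ ℤ.≤ κ j
    -1≤κ zero    = ℤP.≤-refl
    -1≤κ (suc j) = ℤ.-≤+
    κ≤n : ∀ j → j ℕ.≤ suc n → κ j ℤ.≤ + n
    κ≤n zero    _         = ℤ.-≤+
    κ≤n (suc j) (s≤s j≤n) = ℤ.+≤+ j≤n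

  A-vanishes : ∀ n j → n ℕ.< j → A a d n (κ j) ≈ 0#
  A-vanishes zero    (suc j) _ = refl
  A-vanishes (suc n) (suc j) (s≤s n<j) with + j ℤ.≤? + n
  ... | yes (ℤ.+≤+ j≤n) = ⊥-elim (ℕP.<⇒≱ n<j j≤n)
  ... | no _             = refl

  A-below : ∀ n → A a d n -[1+ 1 ] ≈ 0#
  A-below zero    = refl
  A-below (suc n) = refl

  A≈closed : ∀ n j → A a d n (κ j) ≈ S n j
  A≈closed zero    zero    = solve 0 (con (+ 1) := con (+ 1) :* con (+ 1) :* (con (+ 1) :+ con (+ 0))) refl
  A≈closed zero    (suc j) = trans (A-vanishes 0 (suc j) (s≤s z≤n)) (sym (closed-vanishes 0 (suc j) (s≤s z≤n)))
  A≈closed (suc n) j with j ℕ.≤? suc n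
  ... | no j≰1+n = trans (A-vanishes (suc n) j (ℕP.≰⇒> j≰1+n)) (sym (closed-vanishes (suc n) j (ℕP.≰⇒> j≰1+n)))
  ... | yes j≤1+n = begin
    A a d (suc n) (κ j)                                       ≈⟨ A-recurrence n j j≤1+n ⟩
    X j * A a d n (κ j) + Y n j * A a d n (κ j ℤ.- + 1)       ≈⟨ +-cong (*-congˡ (A≈closed n j)) (*-congˡ (lower j)) ⟩
    X j * S n j + Y n j * S₋ n j                              ≈⟨ closed-recurrence n j ⟨
    S (suc n) j                                               ∎
    where
    lower : ∀ j → A a d n (κ j ℤ.- + 1) ≈ S₋ n j
    lower zero    = A-below n
    lower (suc j) = trans (reflexive (≡.cong (A a d n) (κ-pred j))) (A≈closed n j)

  RHS≈closed : ∀ n j → RHS a d n (κ j) ≈ S n j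
  RHS≈closed n j = begin
    sumTo ℤ.∣ κ j ℤ.+ + 1 ∣ summand ≡⟨ ≡.cong (λ m → sumTo m summand) (upper-index j) ⟩
    sumTo j summand                 ≈⟨ sumTo-cong j (λ i → *-congʳ (*-congˡ (^-congˡ n (+-congʳ (*-congʳ (base i)))))) ⟩
    S n j                           ∎
    where
    summand : ℕ → Carrier
    summand i = ((- 1#) ^ i) * ((fromℤ (κ j ℤ.+ + 2 ℤ.- + i) * d - a) ^ n) * fromℕ (suc n C i)
    upper-index : ∀ j → ℤ.∣ κ j ℤ.+ + 1 ∣ ≡ j
    upper-index zero    = ≡.refl
    upper-index (suc j) = ℕP.+-comm j 1
    base : ∀ i → fromℤ (κ j ℤ.+ + 2 ℤ.- + i) ≈ fromℕ (suc j) - fromℕ i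
    base i = trans (fromℤ-- (κ j ℤ.+ + 2) (+ i)) (+-congʳ (fromℤ-κ+2 j))

  eulerian-closed-form : ∀ n j → A a d n (κ j) ≈ RHS a d n (κ j)
  eulerian-closed-form n j = trans (A≈closed n j) (sym (RHS≈closed n j))

open import Data.Integer using (_≤_; _-_)

-- Lemma 2.5.
lemma2p5 : {c ℓ : Level} (R : CommutativeRing c ℓ) →
    (a d : CommutativeRing.Carrier R) (n : ℕ) (k : ℤ) → -1ℤ ≤ k → k ≤ + n - + 1 →
    CommutativeRing._≈_ R (GeneralEulerian.A R a d n k) (GeneralEulerian.RHS R a d n k)
lemma2p5 R a d n -[1+ zero ]  _             _ = EulerianClosedForm.eulerian-closed-form R a d n 0
lemma2p5 R a d n -[1+ suc m ] (ℤ.-≤- ())    _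
lemma2p5 R a d n (+ m)        _             _ = EulerianClosedForm.eulerian-closed-form R a d n (suc m)
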